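{- Let $D_{4}(n,2)$ denote the number of partitions of $n$ into exactly two parts in which odd parts are distinct. Then $D_{4}(0,2)=D_{4}(1,2)=D_{4}(2,2)=0$, $D_{4}(3,2)=1$, $D_{4}(4,2)=D_{4}(5,2)=D_{4}(6,2)=2$, and for every $n\geq 7$, \[ D_{4}(n,2)=D_{4}(n-4,2)+2. \] -}

module Defs where

open import Data.Nat using (ℕ; zero; suc; _+_; _∸_; _≤?_; _≟_; _%_)
open import Data.Bool using (Bool; _∧_; not)
open import Data.List using (List; length; upTo; mapMaybe; filterᵇ)
open import Data.Maybe using (Maybe; just; nothing)
open import Data.Product using (_×_; _,_)
open import Relation.Nullary using (yes; no)
open import Relation.Nullary.Decidable using (⌊_⌋)

-- A partition of n into exactly two parts is a pair (a , b) of positive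
-- integers with a ≥ b and a + b = n (parts in weakly decreasing order).
pickPart : ℕ → ℕ → Maybe (ℕ × ℕ)
pickPart n zero = nothing
pickPart n (suc k) with suc k ≤? n ∸ suc k
... | yes _ = just (n ∸ suc k , suc k)
... | no _  = nothing

twoPartPartitions : ℕ → List (ℕ × ℕ)
twoPartPartitions n = mapMaybe (pickPart n) (upTo (suc n))

isOdd : ℕ → Bool
isOdd m = ⌊ m % 2 ≟ 1 ⌋

-- "Odd parts are distinct": a two-part partition (a , b) repeats an odd part
-- exactly when a = b and a is odd.
oddPartsDistinct : ℕ × ℕ → Bool
oddPartsDistinct (a , b) = not (⌊ a ≟ b ⌋ ∧ isOdd a)

D4-2 : ℕ → ℕ
D4-2 n = length (filterᵇ oddPartsDistinct (twoPartPartitions n))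

{-# OPTIONS --safe #-}
-- A two-part partition of n is (n − b , b) with 1 ≤ b ≤ n / 2, and its odd parts
-- are distinct unless it is (b , b) with b odd.  Counting the possible b gives
-- D₄(2h + 1, 2) = h and D₄(2h + 2, 2) = h + [h + 1 even]; both grow by exactly 2
-- when h grows by 2, so D₄(m + 4, 2) = D₄(m, 2) + 2 holds for every m ≥ 0.
module Submission where

open import Defs
open import Data.Bool using (Bool; true; false; not; _∧_; if_then_else_)
open import Data.List using (List; [_]; _++_; length; upTo; mapMaybe; filterᵇ)
open import Data.List.Properties using (length-++; filter-++; mapMaybe-++; upTo-∷ʳ)
open import Data.Maybe using (just; nothing)
open import Data.Nat using (ℕ; zero; suc; _+_; _∸_; _≤_; _<_; _≤?_; _≟_; s≤s)
open import Data.Nat.Properties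
open import Data.Product using (_×_; _,_)
open import Function using (_∘_)
open import Relation.Binary.PropositionalEquality
  using (_≡_; _≢_; refl; sym; trans; cong; cong₂; subst; module ≡-Reasoning)
open import Relation.Nullary using (yes; no; contradiction)
open import Relation.Nullary.Decidable using (T?; isYes≗does; dec-true; dec-false)

indicator : Bool → ℕ
indicator b = if b then 1 else 0

length-filterᵇ-singleton : ∀ {a} {A : Set a} (p : A → Bool) (x : A) →
                           length (filterᵇ p [ x ]) ≡ indicator (p x)
length-filterᵇ-singleton p x with p x
... | true  = refl
... | false = refl

data Halving : ℕ → Set where
  even : ∀ h → Halving (h + h)
  odd  : ∀ h → Halving (suc (h + h))

halving : ∀ m → Halving m
halving zero = even zero
halving (suc m) with halving m
... | even h = odd h
... | odd h  = subst Halving (cong suc (+-suc h h)) (even (suc h))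

4+[m+m]≡[2+m]+[2+m] : ∀ m → 4 + (m + m) ≡ (2 + m) + (2 + m)
4+[m+m]≡[2+m]+[2+m] m = sym (cong (2 +_) (trans (+-suc m (suc m)) (cong suc (+-suc m m))))

m+m<n⇒n∸m≢m : ∀ {m n} → m + m < n → n ∸ m ≢ m
m+m<n⇒n∸m≢m {m} {n} m+m<n n∸m≡m = <-irrefl m+m≡n m+m<n
  where
  m+m≡n : m + m ≡ n
  m+m≡n = trans (cong (m +_) (sym n∸m≡m)) (m+[n∸m]≡n (≤-trans (m≤m+n m m) (<⇒≤ m+m<n)))

oddPartsDistinct-≢ : ∀ {a b} → a ≢ b → oddPartsDistinct (a , b) ≡ true
oddPartsDistinct-≢ {a} {b} a≢b = cong (λ e → not (e ∧ isOdd a)) (trans (isYes≗does (a ≟ b)) (dec-false (a ≟ b) a≢b))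

oddPartsDistinct-diagonal : ∀ a → oddPartsDistinct (a , a) ≡ not (isOdd a)
oddPartsDistinct-diagonal a = cong (λ e → not (e ∧ isOdd a)) (trans (isYes≗does (a ≟ a)) (dec-true (a ≟ a) refl))

pickPart-smaller : ∀ n b → suc b + suc b ≤ n → pickPart n (suc b) ≡ just (n ∸ suc b , suc b)
pickPart-smaller n b 2b≤n with suc b ≤? n ∸ suc b
... | yes _    = refl
... | no  b≰n∸b = contradiction (m+n≤o⇒m≤o∸n (suc b) 2b≤n) b≰n∸b

pickPart-larger : ∀ n b → n < b + b → pickPart n b ≡ nothing
pickPart-larger n zero    _      = refl
pickPart-larger n (suc b) n<2b with suc b ≤? n ∸ suc b
... | yes b≤n∸b = contradiction (m≤o∸n⇒m+n≤o (suc b) (≤-trans b≤n∸b (m∸n≤m n (suc b))) b≤n∸b) (<⇒≱ n<2b)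
... | no  _     = refl

-- D4-2 n unfolds to countSmallerParts n (upTo (suc n)).
countSmallerParts : ℕ → List ℕ → ℕ
countSmallerParts n bs = length (filterᵇ oddPartsDistinct (mapMaybe (pickPart n) bs))

countSmallerParts-++ : ∀ n bs cs →
                       countSmallerParts n (bs ++ cs) ≡ countSmallerParts n bs + countSmallerParts n cs
countSmallerParts-++ n bs cs = begin
  length (filterᵇ oddPartsDistinct (mapMaybe (pickPart n) (bs ++ cs)))
    ≡⟨ cong (length ∘ filterᵇ oddPartsDistinct) (mapMaybe-++ (pickPart n) bs cs) ⟩
  length (filterᵇ oddPartsDistinct (parts bs ++ parts cs))
    ≡⟨ cong length (filter-++ (T? ∘ oddPartsDistinct) (parts bs) (parts cs)) ⟩
  length (filterᵇ oddPartsDistinct (parts bs) ++ filterᵇ oddPartsDistinct (parts cs))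
    ≡⟨ length-++ (filterᵇ oddPartsDistinct (parts bs)) ⟩
  countSmallerParts n bs + countSmallerParts n cs ∎
  where
  open ≡-Reasoning
  parts : List ℕ → List (ℕ × ℕ)
  parts = mapMaybe (pickPart n)

countSmallerParts-[just] : ∀ {n b p} → pickPart n b ≡ just p →
                           countSmallerParts n [ b ] ≡ indicator (oddPartsDistinct p)
countSmallerParts-[just] {p = p} eq rewrite eq = length-filterᵇ-singleton oddPartsDistinct p

countSmallerParts-[smaller] : ∀ n b → suc b + suc b < n → countSmallerParts n [ suc b ] ≡ 1
countSmallerParts-[smaller] n b 2b<n = begin
  countSmallerParts n [ suc b ]
    ≡⟨ countSmallerParts-[just] (pickPart-smaller n b (<⇒≤ 2b<n)) ⟩
  indicator (oddPartsDistinct (n ∸ suc b , suc b))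
    ≡⟨ cong indicator (oddPartsDistinct-≢ (m+m<n⇒n∸m≢m {suc b} 2b<n)) ⟩
  1 ∎
  where open ≡-Reasoning

countSmallerParts-[half] : ∀ b → countSmallerParts (suc b + suc b) [ suc b ] ≡ indicator (not (isOdd (suc b)))
countSmallerParts-[half] b = begin
  countSmallerParts (suc b + suc b) [ suc b ]
    ≡⟨ countSmallerParts-[just] (pickPart-smaller (suc b + suc b) b ≤-refl) ⟩
  indicator (oddPartsDistinct (suc b + suc b ∸ suc b , suc b))
    ≡⟨ cong (λ a → indicator (oddPartsDistinct (a , suc b))) (m+n∸n≡m (suc b) (suc b)) ⟩
  indicator (oddPartsDistinct (suc b , suc b))
    ≡⟨ cong indicator (oddPartsDistinct-diagonal (suc b)) ⟩
  indicator (not (isOdd (suc b))) ∎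
  where open ≡-Reasoning

countSmallerParts-[larger] : ∀ n b → n < b + b → countSmallerParts n [ b ] ≡ 0
countSmallerParts-[larger] n b n<2b rewrite pickPart-larger n b n<2b = refl

countSmallerParts-upTo-suc : ∀ n m → countSmallerParts n (upTo (suc m)) ≡
                                    countSmallerParts n (upTo m) + countSmallerParts n [ m ]
countSmallerParts-upTo-suc n m =
  trans (cong (countSmallerParts n) (sym (upTo-∷ʳ m))) (countSmallerParts-++ n (upTo m) [ m ])

countSmallerParts-upTo-smaller : ∀ n m → m + m < n → countSmallerParts n (upTo (suc m)) ≡ m
countSmallerParts-upTo-smaller n zero    _      = refl
countSmallerParts-upTo-smaller n (suc m) 2m+2<n = begin
  countSmallerParts n (upTo (suc (suc m)))
    ≡⟨ countSmallerParts-upTo-suc n (suc m) ⟩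
  countSmallerParts n (upTo (suc m)) + countSmallerParts n [ suc m ]
    ≡⟨ cong₂ _+_ (countSmallerParts-upTo-smaller n m 2m<n) (countSmallerParts-[smaller] n m 2m+2<n) ⟩
  m + 1
    ≡⟨ +-comm m 1 ⟩
  suc m ∎
  where
  open ≡-Reasoning
  2m<n : m + m < n
  2m<n = <-trans (+-mono-< (n<1+n m) (n<1+n m)) 2m+2<n

countSmallerParts-upTo-larger : ∀ n m j → n < m + m →
                                countSmallerParts n (upTo (m + j)) ≡ countSmallerParts n (upTo m)
countSmallerParts-upTo-larger n m zero    _    = cong (countSmallerParts n ∘ upTo) (+-identityʳ m)
countSmallerParts-upTo-larger n m (suc j) n<2m = begin
  countSmallerParts n (upTo (m + suc j))
    ≡⟨ cong (countSmallerParts n ∘ upTo) (+-suc m j) ⟩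
  countSmallerParts n (upTo (suc (m + j)))
    ≡⟨ countSmallerParts-upTo-suc n (m + j) ⟩
  countSmallerParts n (upTo (m + j)) + countSmallerParts n [ m + j ]
    ≡⟨ cong₂ _+_ (countSmallerParts-upTo-larger n m j n<2m) (countSmallerParts-[larger] n (m + j) n<2[m+j]) ⟩
  countSmallerParts n (upTo m) + 0
    ≡⟨ +-identityʳ _ ⟩
  countSmallerParts n (upTo m) ∎
  where
  open ≡-Reasoning
  n<2[m+j] : n < (m + j) + (m + j)
  n<2[m+j] = <-≤-trans n<2m (+-mono-≤ (m≤m+n m j) (m≤m+n m j))

D4-2-odd : ∀ h → D4-2 (suc (h + h)) ≡ h
D4-2-odd h = begin
  countSmallerParts n (upTo (suc n))       ≡⟨ cong (countSmallerParts n ∘ upTo ∘ suc) (sym (+-suc h h)) ⟩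
  countSmallerParts n (upTo (suc h + suc h)) ≡⟨ countSmallerParts-upTo-larger n (suc h) (suc h) n<2[1+h] ⟩
  countSmallerParts n (upTo (suc h))       ≡⟨ countSmallerParts-upTo-smaller n h ≤-refl ⟩
  h                                        ∎
  where
  open ≡-Reasoning
  n = suc (h + h)
  n<2[1+h] : n < suc h + suc h
  n<2[1+h] = s≤s (≤-reflexive (sym (+-suc h h)))

D4-2-even : ∀ h → D4-2 (suc h + suc h) ≡ h + indicator (not (isOdd (suc h)))
D4-2-even h = begin
  countSmallerParts n (upTo (suc (suc h) + suc h))
    ≡⟨ countSmallerParts-upTo-larger n (suc (suc h)) (suc h) (+-mono-< (n<1+n (suc h)) (n<1+n (suc h))) ⟩
  countSmallerParts n (upTo (suc (suc h)))
    ≡⟨ countSmallerParts-upTo-suc n (suc h) ⟩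
  countSmallerParts n (upTo (suc h)) + countSmallerParts n [ suc h ]
    ≡⟨ cong₂ _+_ (countSmallerParts-upTo-smaller n h (+-mono-< (n<1+n h) (n<1+n h))) (countSmallerParts-[half] h) ⟩
  h + indicator (not (isOdd (suc h))) ∎
  where
  open ≡-Reasoning
  n = suc h + suc h

D4-2-4+ : ∀ m → D4-2 (4 + m) ≡ D4-2 m + 2
D4-2-4+ m with halving m
... | even zero    = refl
... | even (suc h) = begin
  D4-2 (4 + (suc h + suc h))                ≡⟨ cong D4-2 (4+[m+m]≡[2+m]+[2+m] (suc h)) ⟩
  D4-2 (suc (2 + h) + suc (2 + h))          ≡⟨ D4-2-even (2 + h) ⟩
  2 + (h + indicator (not (isOdd (suc h)))) ≡⟨ +-comm 2 _ ⟩
  h + indicator (not (isOdd (suc h))) + 2   ≡⟨ cong (_+ 2) (D4-2-even h) ⟨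
  D4-2 (suc h + suc h) + 2                  ∎
  where open ≡-Reasoning
... | odd h = begin
  D4-2 (4 + suc (h + h))         ≡⟨ cong (D4-2 ∘ suc) (4+[m+m]≡[2+m]+[2+m] h) ⟩
  D4-2 (suc ((2 + h) + (2 + h))) ≡⟨ D4-2-odd (2 + h) ⟩
  2 + h                          ≡⟨ +-comm 2 h ⟩
  h + 2                          ≡⟨ cong (_+ 2) (D4-2-odd h) ⟨
  D4-2 (suc (h + h)) + 2         ∎
  where open ≡-Reasoning

corollary1 : (D4-2 0 ≡ 0 × D4-2 1 ≡ 0 × D4-2 2 ≡ 0 × D4-2 3 ≡ 1 × D4-2 4 ≡ 2 × D4-2 5 ≡ 2 × D4-2 6 ≡ 2)
    × (∀ (n : ℕ) → 7 ≤ n → D4-2 n ≡ D4-2 (n ∸ 4) + 2)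
corollary1 = (refl , refl , refl , refl , refl , refl , refl) , recurrence
  where
  recurrence : ∀ n → 7 ≤ n → D4-2 n ≡ D4-2 (n ∸ 4) + 2
  recurrence n 7≤n = begin
    D4-2 n              ≡⟨ cong D4-2 (m+[n∸m]≡n (≤-trans (m≤m+n 4 3) 7≤n)) ⟨
    D4-2 (4 + (n ∸ 4))  ≡⟨ D4-2-4+ (n ∸ 4) ⟩
    D4-2 (n ∸ 4) + 2    ∎
    where open ≡-Reasoning
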